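{- For every $2$-regular graph $H$ with $\mathrm{odd}(H)$ odd components, $$c(H)\ge \frac{v(H)+\mathrm{odd}(H)}{2}-1.$$
   Context: All graphs are finite and simple. For a graph $G$, $v(G)$ and $e(G)$ denote its numbers of vertices and edges. A graph $H$ is a minor of $G$ if a graph isomorphic to $H$ can be obtained from a subgraph of $G$ by contracting edges. For a graph $H$ with $v(H)\ge 2$, $c(H)$ is the supremum of $e(G)/v(G)$ over all non-null graphs $G$ not containing $H$ as a minor. $\mathrm{odd}(H)$ is the number of connected components of $H$ with an odd number of vertices. -}

module Defs where

open import Data.Nat using (ℕ; zero; suc; _+_; _*_; _<ᵇ_; _≡ᵇ_; _%_)
open import Data.Fin using (Fin; toℕ; punchIn; _≟_)
open import Data.Bool using (Bool; true; false; _∧_; _∨_; not; if_then_else_)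
open import Data.List using (List; map; allFin; foldr)
open import Data.Nat.ListAction using (sum)
open import Relation.Nullary.Decidable using (⌊_⌋)
open import Relation.Binary.PropositionalEquality using (_≡_)
open import Relation.Binary.Definitions using (Decidable)

-- A graph on vertex set Fin n is given by a Boolean matrix `raw`; its
-- edge relation is the symmetric, irreflexive closure `Adj` of `raw`.
-- Thus every simple graph on Fin n is represented (by its own adjacency
-- matrix), and every value of the type is a simple graph.

record Graph (n : ℕ) : Set where
  constructor graph
  field raw : Fin n → Fin n → Bool
open Graph public

_==_ : ∀ {n} → Fin n → Fin n → Bool
x == y = ⌊ x ≟ y ⌋

Adj : ∀ {n} → Graph n → Fin n → Fin n → Bool
Adj G x y = not (x == y) ∧ (raw G x y ∨ raw G y x)

countF : ∀ n → (Fin n → Bool) → ℕ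
countF n P = sum (map (λ x → if P x then 1 else 0) (allFin n))

sumF : ∀ n → (Fin n → ℕ) → ℕ
sumF n f = sum (map f (allFin n))

allF : ∀ n → (Fin n → Bool) → Bool
allF n P = foldr (λ x b → P x ∧ b) true (allFin n)

-- v(G) is the index n; e(G) = number of unordered adjacent pairs
e : ∀ {n} → Graph n → ℕ
e {n} G = sumF n (λ x → countF n (λ y → (toℕ x <ᵇ toℕ y) ∧ Adj G x y))

deg : ∀ {n} → Graph n → Fin n → ℕ
deg {n} G x = countF n (λ y → Adj G x y)

TwoRegular : ∀ {n} → Graph n → Set
TwoRegular G = ∀ x → deg G x ≡ 2

data Reach {n} (G : Graph n) (x : Fin n) : Fin n → Set where
  here : Reach G x x
  step : ∀ {y z} → Reach G x y → Adj G y z ≡ true → Reach G x z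

-- Each component is counted through its least vertex.  The count uses a
-- decision procedure for reachability (any one; the result does not
-- depend on the choice).
odd : ∀ {n} (G : Graph n) → Decidable (Reach G) → ℕ
odd {n} G dec = countF n (λ x → isRep x ∧ (size x % 2 ≡ᵇ 1))
  where
  r : Fin n → Fin n → Bool
  r x y = ⌊ dec x y ⌋
  isRep : Fin n → Bool
  isRep x = allF n (λ y → not ((toℕ y <ᵇ toℕ x) ∧ r y x))
  size : Fin n → ℕ
  size x = countF n (r x)

deleteVertex : ∀ {m} → Graph (suc m) → Fin (suc m) → Graph m
deleteVertex G v = graph (λ x y → Adj G (punchIn v x) (punchIn v y))

deleteEdge : ∀ {n} → Graph n → Fin n → Fin n → Graph n
deleteEdge G i j =
  graph (λ x y → Adj G x y ∧ not ((x == i ∧ y == j) ∨ (x == j ∧ y == i)))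

-- contract the edge ij: vertex j is removed and its neighbours become
-- neighbours of i (loops discarded by Adj)
contract : ∀ {m} → Graph (suc m) → Fin (suc m) → Fin (suc m) → Graph m
contract G i j = graph λ x y →
  Adj G (f x) (f y) ∨ (f x == i ∧ Adj G j (f y)) ∨ (f y == i ∧ Adj G j (f x))
  where f = punchIn j

record _≅_ {h n} (H : Graph h) (G : Graph n) : Set where
  field
    to   : Fin h → Fin n
    from : Fin n → Fin h
    from-to : ∀ x → from (to x) ≡ x
    to-from : ∀ y → to (from y) ≡ y
    adj-pres : ∀ x y → Adj H x y ≡ Adj G (to x) (to y)

data Minor {h} (H : Graph h) : ∀ {n} → Graph n → Set where
  iso  : ∀ {n} {G : Graph n} → H ≅ G → Minor H G
  delV : ∀ {m} {G : Graph (suc m)} (v : Fin (suc m)) →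
         Minor H (deleteVertex G v) → Minor H G
  delE : ∀ {n} {G : Graph n} (i j : Fin n) →
         Minor H (deleteEdge G i j) → Minor H G
  con  : ∀ {m} {G : Graph (suc m)} (i j : Fin (suc m)) → Adj G i j ≡ true →
         Minor H (contract G i j) → Minor H G

module Submission where

-- A vertex cover with at most s vertices survives every minor operation: deleting
-- vertices or edges keeps a cover, and a contracted vertex can inherit the label of a
-- covered endpoint.  In a 2-regular graph every edge at an uncovered vertex ends at a
-- covered vertex of the same component, and all degrees are 2, so each component has at
-- least as many covered as uncovered vertices, strictly more when it is odd; summing,
-- every vertex cover of H has at least (v(H) + odd(H))/2 vertices.  Hence for
-- 2s < v(H) + odd(H) the complete bipartite graph K(s, N) has no H minor, while its
-- density sN/(s + N) exceeds any p/m < s once N > ps.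

open import Defs
open import Data.Bool using (Bool; true; false; _∧_; _∨_; not; if_then_else_; T)
open import Data.Bool.Properties
  using (∧-conicalˡ; ∧-conicalʳ; ∨-comm; not-injective; T-≡; T-not-≡)
open import Data.Empty using (⊥-elim)
open import Data.Fin using (Fin; zero; suc; toℕ; punchIn; _≟_; splitAt; _↑ˡ_; _↑ʳ_)
open import Data.Fin.Induction using (<-wellFounded)
import Data.Fin.Properties as Fin
open import Data.List using (tabulate; foldr; allFin)
open import Data.List.Properties using (map-tabulate; foldr-map)
open import Data.Maybe using (Maybe; just; nothing; is-just)
open import Data.Nat
  using (ℕ; zero; suc; _+_; _*_; _≤_; _<_; _≥_; z≤n; s≤s; _<ᵇ_; _≡ᵇ_; _%_; NonZero)
open import Data.Nat.DivMod using (m*n%n≡0)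
import Data.Nat.ListAction as List
open import Data.Nat.Properties hiding (_≟_)
open import Data.Nat.Tactic.RingSolver using (solve-∀)
open import Data.Product using (Σ; _×_; ∃-syntax; _,_)
open import Data.Sum using (_⊎_; inj₁; inj₂; [_,_]′; swap) renaming (map to map⊎)
open import Function using (_∘_; id; const; case_of_)
open import Function.Bundles using (module Equivalence)
open import Induction.WellFounded using (module All)
open import Relation.Binary.Definitions using (Decidable; tri<; tri≈; tri>)
open import Relation.Binary.PropositionalEquality
open import Relation.Nullary using (¬_; yes; no)
open import Relation.Nullary.Decidable
  using (Dec; ⌊_⌋; toWitness; fromWitness; fromWitnessFalse)

open import Algebra.Properties.CommutativeSemigroup *-commutativeSemigroup using (x∙yz≈y∙xz)
open import Algebra.Properties.Semiring.Sum +-*-semiring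
  using (sum; sum-syntax; sum-cong-≗; sum-replicate-zero; ∑-distrib-+; ∑-comm; *-distribˡ-sum)

ind : Bool → ℕ
ind b = if b then 1 else 0

ind-∧ : ∀ a b → ind (a ∧ b) ≡ ind a * ind b
ind-∧ true b = sym (+-identityʳ (ind b))
ind-∧ false b = refl

ind-mono : ∀ {a b} → (a ≡ true → b ≡ true) → ind a ≤ ind b
ind-mono {false} _ = z≤n
ind-mono {true} a⇒b rewrite a⇒b refl = ≤-refl

ind≤1 : ∀ b → ind b ≤ 1
ind≤1 true = ≤-refl
ind≤1 false = z≤n

∧-false : ∀ a b → a ∧ b ≡ false → a ≡ false ⊎ b ≡ false
∧-false false _ _ = inj₁ refl
∧-false true _ b = inj₂ b

∨-true : ∀ a b → a ∨ b ≡ true → a ≡ true ⊎ b ≡ true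
∨-true true _ _ = inj₁ refl
∨-true false _ b = inj₂ b

T⇒≡true : ∀ {b} → T b → b ≡ true
T⇒≡true = Equivalence.to T-≡

≡true⇒T : ∀ {b} → b ≡ true → T b
≡true⇒T = Equivalence.from T-≡

⌊⌋≡true⇒ : ∀ {A : Set} {a? : Dec A} → ⌊ a? ⌋ ≡ true → A
⌊⌋≡true⇒ = toWitness ∘ ≡true⇒T

⌊⌋≡true : ∀ {A : Set} (a? : Dec A) → A → ⌊ a? ⌋ ≡ true
⌊⌋≡true a? = T⇒≡true ∘ fromWitness

⌊⌋≡false : ∀ {A : Set} (a? : Dec A) → ¬ A → ⌊ a? ⌋ ≡ false
⌊⌋≡false a? = Equivalence.to T-not-≡ ∘ fromWitnessFalse

sumF≡∑ : ∀ n (f : Fin n → ℕ) → sumF n f ≡ ∑[ x < n ] f x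
sumF≡∑ n f = trans (cong List.sum (map-tabulate id f)) (go n f)
  where
  go : ∀ n (f : Fin n → ℕ) → List.sum (tabulate f) ≡ sum f
  go zero f = refl
  go (suc n) f = cong (f zero +_) (go n (f ∘ suc))

sumF≡∑² : ∀ m n (f : Fin m → Fin n → ℕ) →
  sumF m (λ x → sumF n (f x)) ≡ ∑[ x < m ] ∑[ y < n ] f x y
sumF≡∑² m n f = trans (sumF≡∑ m _) (sum-cong-≗ (λ x → sumF≡∑ n (f x)))

sumF-cong : ∀ n {f g : Fin n → ℕ} → (∀ x → f x ≡ g x) → sumF n f ≡ sumF n g
sumF-cong n {f} {g} f≗g = begin
  sumF n f ≡⟨ sumF≡∑ n f ⟩
  sum f    ≡⟨ sum-cong-≗ f≗g ⟩
  sum g    ≡⟨ sumF≡∑ n g ⟨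
  sumF n g ∎
  where open ≡-Reasoning

sumF-distrib-+ : ∀ n (f g : Fin n → ℕ) → sumF n (λ x → f x + g x) ≡ sumF n f + sumF n g
sumF-distrib-+ n f g = begin
  sumF n (λ x → f x + g x) ≡⟨ sumF≡∑ n _ ⟩
  ∑[ x < n ] (f x + g x)   ≡⟨ ∑-distrib-+ f g ⟩
  sum f + sum g            ≡⟨ cong₂ _+_ (sumF≡∑ n f) (sumF≡∑ n g) ⟨
  sumF n f + sumF n g      ∎
  where open ≡-Reasoning

*-distribˡ-sumF : ∀ n c (f : Fin n → ℕ) → c * sumF n f ≡ sumF n (λ x → c * f x)
*-distribˡ-sumF n c f = begin
  c * sumF n f           ≡⟨ cong (c *_) (sumF≡∑ n f) ⟩
  c * sum f              ≡⟨ *-distribˡ-sum c f ⟩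
  ∑[ x < n ] (c * f x)   ≡⟨ sumF≡∑ n _ ⟨
  sumF n (λ x → c * f x) ∎
  where open ≡-Reasoning

sumF-comm : ∀ m n (f : Fin m → Fin n → ℕ) →
  sumF m (λ x → sumF n (f x)) ≡ sumF n (λ y → sumF m (λ x → f x y))
sumF-comm m n f = begin
  sumF m (λ x → sumF n (f x))         ≡⟨ sumF≡∑² m n f ⟩
  ∑[ x < m ] ∑[ y < n ] f x y         ≡⟨ ∑-comm f ⟩
  ∑[ y < n ] ∑[ x < m ] f x y         ≡⟨ sumF≡∑² n m (λ y x → f x y) ⟨
  sumF n (λ y → sumF m (λ x → f x y)) ∎
  where open ≡-Reasoning

∑-mono-≤ : ∀ {n} {f g : Fin n → ℕ} → (∀ x → f x ≤ g x) → sum f ≤ sum g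
∑-mono-≤ {zero} f≤g = z≤n
∑-mono-≤ {suc n} f≤g = +-mono-≤ (f≤g zero) (∑-mono-≤ (f≤g ∘ suc))

sumF-mono-≤ : ∀ n {f g : Fin n → ℕ} → (∀ x → f x ≤ g x) → sumF n f ≤ sumF n g
sumF-mono-≤ n {f} {g} f≤g =
  subst₂ _≤_ (sym (sumF≡∑ n f)) (sym (sumF≡∑ n g)) (∑-mono-≤ f≤g)

∑-const : ∀ n c → ∑[ _ < n ] c ≡ n * c
∑-const zero c = refl
∑-const (suc n) c = cong (c +_) (∑-const n c)

sumF-const : ∀ n c → sumF n (λ _ → c) ≡ n * c
sumF-const n c = trans (sumF≡∑ n _) (∑-const n c)

term≤∑ : ∀ {n} (f : Fin n → ℕ) x → f x ≤ sum f
term≤∑ f zero = m≤m+n _ _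
term≤∑ f (suc x) = ≤-trans (term≤∑ (f ∘ suc) x) (m≤n+m _ _)

∑-↑ : ∀ m n (f : Fin (m + n) → ℕ) →
  sum f ≡ ∑[ x < m ] f (x ↑ˡ n) + ∑[ y < n ] f (m ↑ʳ y)
∑-↑ zero n f = refl
∑-↑ (suc m) n f = trans (cong (f zero +_) (∑-↑ m n (f ∘ suc))) (sym (+-assoc (f zero) _ _))

countF-≤1 : ∀ n {P : Fin n → Bool} →
  (∀ {x y} → P x ≡ true → P y ≡ true → x ≡ y) → countF n P ≤ 1
countF-≤1 n {P} atMostOne = subst (_≤ 1) (sym (sumF≡∑ n (ind ∘ P))) (go P atMostOne)
  where
  go : ∀ {n} (P : Fin n → Bool) → (∀ {x y} → P x ≡ true → P y ≡ true → x ≡ y) →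
       sum (ind ∘ P) ≤ 1
  go {zero} P _ = z≤n
  go {suc n} P atMostOne with P zero in P0
  ... | false = go (P ∘ suc) (λ px py → Fin.suc-injective (atMostOne px py))
  ... | true = s≤s (≤-reflexive (trans (sum-cong-≗ none) (sum-replicate-zero n)))
    where
    none : ∀ x → ind (P (suc x)) ≡ 0
    none x with P (suc x) in Px
    ... | false = refl
    ... | true = case atMostOne P0 Px of λ ()

countF-unique : ∀ n {P : Fin n → Bool} w → P w ≡ true →
  (∀ {x} → P x ≡ true → x ≡ w) → countF n P ≡ 1
countF-unique n {P} w Pw onlyW = ≤-antisym
  (countF-≤1 n (λ Px Py → trans (onlyW Px) (sym (onlyW Py))))
  (subst₂ _≤_ (cong ind Pw) (sym (sumF≡∑ n (ind ∘ P))) (term≤∑ (ind ∘ P) w))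

allF-suc : ∀ n (P : Fin (suc n) → Bool) → allF (suc n) P ≡ P zero ∧ allF n (P ∘ suc)
allF-suc n P = cong (P zero ∧_)
  (trans (cong (foldr (λ x b → P x ∧ b) true) (sym (map-tabulate {n = n} id suc)))
         (foldr-map (λ x b → P x ∧ b) suc true (allFin n)))

allF⇒ : ∀ n {P : Fin n → Bool} → allF n P ≡ true → ∀ x → P x ≡ true
allF⇒ (suc n) {P} all zero = ∧-conicalˡ _ _ (trans (sym (allF-suc n P)) all)
allF⇒ (suc n) {P} all (suc x) = allF⇒ n (∧-conicalʳ _ _ (trans (sym (allF-suc n P)) all)) x

allF-false⇒ : ∀ n {P : Fin n → Bool} → allF n P ≡ false → ∃[ x ] P x ≡ false
allF-false⇒ (suc n) {P} notAll with ∧-false (P zero) _ (trans (sym (allF-suc n P)) notAll)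
... | inj₁ P0 = zero , P0
... | inj₂ rest = let x , Px = allF-false⇒ n rest in suc x , Px

Adj-sym : ∀ {n} (G : Graph n) x y → Adj G x y ≡ Adj G y x
Adj-sym G x y with x ≟ y | y ≟ x
... | yes _   | yes _   = refl
... | no _    | no _    = ∨-comm (raw G x y) (raw G y x)
... | yes x≡y | no y≢x  = ⊥-elim (y≢x (sym x≡y))
... | no x≢y  | yes y≡x = ⊥-elim (x≢y (sym y≡x))

Adj⇒raw : ∀ {n} (G : Graph n) {x y} →
  Adj G x y ≡ true → raw G x y ≡ true ⊎ raw G y x ≡ true
Adj⇒raw G adj = ∨-true _ _ (∧-conicalʳ _ _ adj)

Reach-trans : ∀ {n} {G : Graph n} {x y z} → Reach G x y → Reach G y z → Reach G x z
Reach-trans x↝y here = x↝y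
Reach-trans x↝y (step y↝z adj) = step (Reach-trans x↝y y↝z) adj

Reach-sym : ∀ {n} {G : Graph n} {x y} → Reach G x y → Reach G y x
Reach-sym here = here
Reach-sym {G = G} (step {y} {z} x↝y adj) =
  Reach-trans (step here (trans (Adj-sym G z y) adj)) (Reach-sym x↝y)

IsVertexCover : ∀ {n} → Graph n → (Fin n → Bool) → Set
IsVertexCover {n} G C = ∀ x y → Adj G x y ≡ true → C x ≡ true ⊎ C y ≡ true

raw-cover⇒IsVertexCover : ∀ {n} (G : Graph n) {C : Fin n → Bool} →
  (∀ x y → raw G x y ≡ true → C x ≡ true ⊎ C y ≡ true) → IsVertexCover G C
raw-cover⇒IsVertexCover G cover x y adj = [ cover x y , swap ∘ cover y x ]′ (Adj⇒raw G adj)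

Regular : ∀ {n} → ℕ → Graph n → Set
Regular d G = ∀ x → deg G x ≡ d

Closed : ∀ {n} → Graph n → (Fin n → Bool) → Set
Closed G S = ∀ {x y} → S x ≡ true → Adj G x y ≡ true → S y ≡ true

countF-split : ∀ n (C S : Fin n → Bool) →
  countF n S ≡ countF n (λ x → not (C x) ∧ S x) + countF n (λ x → C x ∧ S x)
countF-split n C S = trans (sumF-cong n (λ x → split (C x) (S x))) (sumF-distrib-+ n _ _)
  where
  split : ∀ c b → ind b ≡ ind (not c ∧ b) + ind (c ∧ b)
  split true b = refl
  split false b = sym (+-identityʳ (ind b))

n+n%2≡0 : ∀ n → (n + n) % 2 ≡ 0
n+n%2≡0 n = trans (cong (_% 2) n+n≡n*2) (m*n%n≡0 n 2)
  where
  n+n≡n*2 : n + n ≡ n * 2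
  n+n≡n*2 = trans (cong (n +_) (sym (+-identityʳ n))) (*-comm 2 n)

parity-slack : ∀ {a c} → a ≤ c → (a + c) + ind ((a + c) % 2 ≡ᵇ 1) ≤ 2 * c
parity-slack {a} {c} a≤c with m≤n⇒m<n∨m≡n a≤c
... | inj₁ a<c = begin
  (a + c) + ind _ ≤⟨ +-monoʳ-≤ (a + c) (ind≤1 _) ⟩
  (a + c) + 1     ≡⟨ +-comm (a + c) 1 ⟩
  suc a + c       ≤⟨ +-monoˡ-≤ c a<c ⟩
  c + c           ≡⟨ cong (c +_) (+-identityʳ c) ⟨
  2 * c           ∎
  where open ≤-Reasoning
... | inj₂ refl rewrite n+n%2≡0 a =
  ≤-reflexive (trans (+-identityʳ (a + a)) (cong (a +_) (sym (+-identityʳ a))))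

-- Vertex covers of regular graphs

module _ {n d} (G : Graph n) (regular : Regular d G) where

  regular-incidences : ∀ (A : Fin n → Bool) →
    d * countF n A ≡ sumF n (λ x → sumF n (λ y → ind (A x ∧ Adj G x y)))
  regular-incidences A = begin
    d * countF n A
      ≡⟨ *-distribˡ-sumF n d _ ⟩
    sumF n (λ x → d * ind (A x))
      ≡⟨ sumF-cong n (λ x → trans (*-comm d _) (cong (ind (A x) *_) (sym (regular x)))) ⟩
    sumF n (λ x → ind (A x) * deg G x)
      ≡⟨ sumF-cong n (λ x → *-distribˡ-sumF n (ind (A x)) _) ⟩
    sumF n (λ x → sumF n (λ y → ind (A x) * ind (Adj G x y)))
      ≡⟨ sumF-cong n (λ x → sumF-cong n (λ y → ind-∧ (A x) _)) ⟨
    sumF n (λ x → sumF n (λ y → ind (A x ∧ Adj G x y)))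
      ∎
    where open ≡-Reasoning

  module _ .{{_ : NonZero d}} {C : Fin n → Bool} (cover : IsVertexCover G C) where

    uncovered≤covered : ∀ {S} → Closed G S →
      countF n (λ x → not (C x) ∧ S x) ≤ countF n (λ x → C x ∧ S x)
    uncovered≤covered {S} closed = *-cancelˡ-≤ d (begin
      d * countF n U                                         ≡⟨ regular-incidences U ⟩
      sumF n (λ x → sumF n (λ y → ind (U x ∧ Adj G x y)))
        ≤⟨ sumF-mono-≤ n (λ x → sumF-mono-≤ n (λ y → ind-mono (edge-to-cover x y))) ⟩
      sumF n (λ x → sumF n (λ y → ind (K y ∧ Adj G y x)))   ≡⟨ sumF-comm n n _ ⟩
      sumF n (λ y → sumF n (λ x → ind (K y ∧ Adj G y x)))   ≡⟨ regular-incidences K ⟨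
      d * countF n K                                         ∎)
      where
      open ≤-Reasoning
      U K : Fin n → Bool
      U x = not (C x) ∧ S x
      K x = C x ∧ S x
      edge-to-cover : ∀ x y → U x ∧ Adj G x y ≡ true → K y ∧ Adj G y x ≡ true
      edge-to-cover x y Ux∧adj =
        cong₂ _∧_ (cong₂ _∧_ Cy (closed Sx adj)) (trans (Adj-sym G y x) adj)
        where
        Ux : U x ≡ true
        Ux = ∧-conicalˡ (U x) _ Ux∧adj
        adj : Adj G x y ≡ true
        adj = ∧-conicalʳ (U x) _ Ux∧adj
        Sx : S x ≡ true
        Sx = ∧-conicalʳ (not (C x)) _ Ux
        ¬Cx : C x ≡ false
        ¬Cx = not-injective (∧-conicalˡ _ _ Ux)
        Cy : C y ≡ true
        Cy = [ (λ Cx → case trans (sym Cx) ¬Cx of λ ()) , id ]′ (cover x y adj)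

    closed-cover-bound : ∀ {S} → Closed G S →
      countF n S + ind (countF n S % 2 ≡ᵇ 1) ≤ 2 * countF n (λ x → C x ∧ S x)
    closed-cover-bound {S} closed rewrite countF-split n C S =
      parity-slack (uncovered≤covered closed)

-- These repeat the local definitions of odd, so that odd G dec unfolds to
-- countF n (λ x → isRep x ∧ (size x % 2 ≡ᵇ 1)).
module Components {n} (G : Graph n) (dec : Decidable (Reach G)) where

  reach : Fin n → Fin n → Bool
  reach x y = ⌊ dec x y ⌋

  isRep : Fin n → Bool
  isRep x = allF n (λ y → not ((toℕ y <ᵇ toℕ x) ∧ reach y x))

  size : Fin n → ℕ
  size x = countF n (reach x)

  reach-closed : ∀ w → Closed G (reach w)
  reach-closed w w↝x adj = ⌊⌋≡true (dec _ _) (step (⌊⌋≡true⇒ w↝x) adj)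

  rep-minimal : ∀ {w w′} → isRep w′ ≡ true → Reach G w w′ → ¬ (toℕ w < toℕ w′)
  rep-minimal {w} {w′} rep w↝w′ w<w′ = case trans (sym (allF⇒ n rep w)) smaller of λ ()
    where
    smaller : not ((toℕ w <ᵇ toℕ w′) ∧ reach w w′) ≡ false
    smaller = cong₂ (λ a b → not (a ∧ b)) (T⇒≡true (<⇒<ᵇ w<w′))
                    (⌊⌋≡true (dec w w′) w↝w′)

  rep-unique : ∀ {w w′ x} → isRep w ≡ true → isRep w′ ≡ true →
    Reach G w x → Reach G w′ x → w ≡ w′
  rep-unique {w} {w′} rep rep′ w↝x w′↝x with <-cmp (toℕ w) (toℕ w′)
  ... | tri< w<w′ _ _ = ⊥-elim (rep-minimal rep′ (Reach-trans w↝x (Reach-sym w′↝x)) w<w′)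
  ... | tri≈ _ w≡w′ _ = Fin.toℕ-injective w≡w′
  ... | tri> _ _ w′<w = ⊥-elim (rep-minimal rep (Reach-trans w′↝x (Reach-sym w↝x)) w′<w)

  rep-exists : ∀ x → ∃[ w ] isRep w ≡ true × Reach G w x
  rep-exists = All.wfRec <-wellFounded _ _ descend
    where
    descend : ∀ x → (∀ {y} → toℕ y < toℕ x → ∃[ w ] isRep w ≡ true × Reach G w y) →
              ∃[ w ] isRep w ≡ true × Reach G w x
    descend x below with isRep x in rep
    ... | true = x , rep , here
    ... | false with allF-false⇒ n rep
    ...   | y , notSmaller =
      let y<x∧y↝x = not-injective notSmaller
          y<x = <ᵇ⇒< _ _ (≡true⇒T (∧-conicalˡ _ _ y<x∧y↝x))
          y↝x = ⌊⌋≡true⇒ (∧-conicalʳ (toℕ y <ᵇ toℕ x) _ y<x∧y↝x)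
          w , rep′ , w↝y = below y<x
      in w , rep′ , Reach-trans w↝y y↝x

  reps-reaching : ∀ x → countF n (λ w → isRep w ∧ reach w x) ≡ 1
  reps-reaching x =
    let w , rep , w↝x = rep-exists x
    in countF-unique n w (cong₂ _∧_ rep (⌊⌋≡true (dec w x) w↝x))
         λ {w′} rep′∧w′↝x →
         rep-unique (∧-conicalˡ _ _ rep′∧w′↝x) rep
                    (⌊⌋≡true⇒ (∧-conicalʳ (isRep w′) _ rep′∧w′↝x)) w↝x

  countF-by-components : ∀ (A : Fin n → Bool) →
    sumF n (λ w → ind (isRep w) * countF n (λ x → A x ∧ reach w x)) ≡ countF n A
  countF-by-components A = begin
    sumF n (λ w → ind (isRep w) * countF n (λ x → A x ∧ reach w x))
      ≡⟨ sumF-cong n (λ w → *-distribˡ-sumF n (ind (isRep w)) _) ⟩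
    sumF n (λ w → sumF n (λ x → ind (isRep w) * ind (A x ∧ reach w x)))
      ≡⟨ sumF-comm n n _ ⟩
    sumF n (λ x → sumF n (λ w → ind (isRep w) * ind (A x ∧ reach w x)))
      ≡⟨ sumF-cong n (λ x → sumF-cong n (λ w → ind-exchange (isRep w) (A x) (reach w x))) ⟩
    sumF n (λ x → sumF n (λ w → ind (A x) * ind (isRep w ∧ reach w x)))
      ≡⟨ sumF-cong n (λ x → *-distribˡ-sumF n (ind (A x)) _) ⟨
    sumF n (λ x → ind (A x) * countF n (λ w → isRep w ∧ reach w x))
      ≡⟨ sumF-cong n (λ x → trans (cong (ind (A x) *_) (reps-reaching x)) (*-identityʳ _)) ⟩
    countF n A
      ∎
    where
    open ≡-Reasoning
    ind-exchange : ∀ a b c → ind a * ind (b ∧ c) ≡ ind b * ind (a ∧ c)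
    ind-exchange true true c = refl
    ind-exchange true false c = refl
    ind-exchange false true c = refl
    ind-exchange false false c = refl

regular-cover-bound : ∀ {n d} .{{_ : NonZero d}} (G : Graph n) → Regular d G →
  (dec : Decidable (Reach G)) {C : Fin n → Bool} → IsVertexCover G C →
  n + odd G dec ≤ 2 * countF n C
regular-cover-bound {n} G regular dec {C} cover = begin
  n + odd G dec
    ≡⟨ cong₂ _+_ n≡Σsize odd≡Σparity ⟩
  sumF n (λ w → R w * size w) + sumF n (λ w → R w * ind (size w % 2 ≡ᵇ 1))
    ≡⟨ sumF-distrib-+ n _ _ ⟨
  sumF n (λ w → R w * size w + R w * ind (size w % 2 ≡ᵇ 1))
    ≡⟨ sumF-cong n (λ w → *-distribˡ-+ (R w) _ _) ⟨
  sumF n (λ w → R w * (size w + ind (size w % 2 ≡ᵇ 1)))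
    ≤⟨ sumF-mono-≤ n (λ w → *-monoʳ-≤ (R w) (component-bound w)) ⟩
  sumF n (λ w → R w * (2 * c w))
    ≡⟨ sumF-cong n (λ w → x∙yz≈y∙xz (R w) 2 (c w)) ⟩
  sumF n (λ w → 2 * (R w * c w))
    ≡⟨ *-distribˡ-sumF n 2 _ ⟨
  2 * sumF n (λ w → R w * c w)
    ≡⟨ cong (2 *_) (countF-by-components C) ⟩
  2 * countF n C
    ∎
  where
  open Components G dec
  open ≤-Reasoning
  R c : Fin n → ℕ
  R w = ind (isRep w)
  c w = countF n (λ x → C x ∧ reach w x)
  n≡Σsize : n ≡ sumF n (λ w → R w * size w)
  n≡Σsize = sym (trans (countF-by-components (const true))
                       (trans (sumF-const n 1) (*-identityʳ n)))
  odd≡Σparity : odd G dec ≡ sumF n (λ w → R w * ind (size w % 2 ≡ᵇ 1))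
  odd≡Σparity = sumF-cong n (λ w → ind-∧ (isRep w) _)
  component-bound : ∀ w → size w + ind (size w % 2 ≡ᵇ 1) ≤ 2 * c w
  component-bound w = closed-cover-bound G regular cover (reach-closed w)

-- Small vertex covers are inherited by minors

record BoundedCover {n} (G : Graph n) (s : ℕ) : Set where
  field
    label : Fin n → Maybe (Fin s)
    label-injective : ∀ {x y a} → label x ≡ just a → label y ≡ just a → x ≡ y
    covers : IsVertexCover G (is-just ∘ label)
open BoundedCover

labelled : ∀ {s} → Maybe (Fin s) → Fin s → Bool
labelled nothing _ = false
labelled (just b) a = b == a

labelled⇒≡just : ∀ {s} (l : Maybe (Fin s)) {a} → labelled l a ≡ true → l ≡ just a
labelled⇒≡just (just b) b==a = cong just (⌊⌋≡true⇒ b==a)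

is-just≤count-labelled : ∀ {s} (l : Maybe (Fin s)) → ind (is-just l) ≤ countF s (labelled l)
is-just≤count-labelled nothing = z≤n
is-just≤count-labelled {s} (just b) =
  subst₂ _≤_ (cong ind (⌊⌋≡true (b ≟ b) refl)) (sym (sumF≡∑ s _))
    (term≤∑ (ind ∘ (b ==_)) b)

BoundedCover-size : ∀ {n s} {G : Graph n} (κ : BoundedCover G s) →
  countF n (is-just ∘ label κ) ≤ s
BoundedCover-size {n} {s} κ = begin
  countF n (is-just ∘ label κ)
    ≤⟨ sumF-mono-≤ n (is-just≤count-labelled ∘ label κ) ⟩
  sumF n (λ x → countF s (labelled (label κ x)))
    ≡⟨ sumF-comm n s _ ⟩
  sumF s (λ a → countF n (λ x → labelled (label κ x) a))
    ≤⟨ sumF-mono-≤ s (λ a → countF-≤1 n (λ {x} {y} → labelled-unique x y)) ⟩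
  sumF s (λ _ → 1)
    ≡⟨ trans (sumF-const s 1) (*-identityʳ s) ⟩
  s ∎
  where
  open ≤-Reasoning
  labelled-unique : ∀ x y {a} →
    labelled (label κ x) a ≡ true → labelled (label κ y) a ≡ true → x ≡ y
  labelled-unique x y x↦a y↦a =
    label-injective κ (labelled⇒≡just (label κ x) x↦a) (labelled⇒≡just (label κ y) y↦a)

BoundedCover-≅ : ∀ {h n s} {H : Graph h} {G : Graph n} →
  H ≅ G → BoundedCover G s → BoundedCover H s
BoundedCover-≅ H≅G κ = record
  { label = label κ ∘ to
  ; label-injective = λ {x} {y} x↦a y↦a →
      trans (sym (from-to x)) (trans (cong from (label-injective κ x↦a y↦a)) (from-to y))
  ; covers = λ x y adj → covers κ (to x) (to y) (trans (sym (adj-pres x y)) adj)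
  }
  where open _≅_ H≅G

BoundedCover-deleteVertex : ∀ {m s} {G : Graph (suc m)} v →
  BoundedCover G s → BoundedCover (deleteVertex G v) s
BoundedCover-deleteVertex v κ = record
  { label = label κ ∘ punchIn v
  ; label-injective = λ x↦a y↦a → Fin.punchIn-injective v _ _ (label-injective κ x↦a y↦a)
  ; covers = raw-cover⇒IsVertexCover _ (λ x y → covers κ (punchIn v x) (punchIn v y))
  }

BoundedCover-deleteEdge : ∀ {n s} {G : Graph n} i j →
  BoundedCover G s → BoundedCover (deleteEdge G i j) s
BoundedCover-deleteEdge i j κ = record
  { label = label κ
  ; label-injective = label-injective κ
  ; covers = raw-cover⇒IsVertexCover _ (λ x y → covers κ x y ∘ ∧-conicalˡ _ _)
  }

module _ {m s} {G : Graph (suc m)} (i j : Fin (suc m)) (κ : BoundedCover G s) where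

  private
    covered : Fin (suc m) → Set
    covered x = is-just (label κ x) ≡ true

  -- The merged vertex is represented by j rather than i when i is uncovered; this is
  -- harmless because then every edge at i already has a covered end.
  merge : Fin m → Fin (suc m)
  merge x = if not (is-just (label κ i)) ∧ (punchIn j x == i) then j else punchIn j x

  merge-injective : ∀ {x y} → merge x ≡ merge y → x ≡ y
  merge-injective {x} {y} eq with is-just (label κ i)
  ... | true = Fin.punchIn-injective j x y eq
  ... | false with punchIn j x == i in x=i | punchIn j y == i in y=i
  ...   | true  | true  =
    Fin.punchIn-injective j x y (trans (⌊⌋≡true⇒ x=i) (sym (⌊⌋≡true⇒ y=i)))
  ...   | true  | false = ⊥-elim (Fin.punchInᵢ≢i j y (sym eq))
  ...   | false | true  = ⊥-elim (Fin.punchInᵢ≢i j x eq)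
  ...   | false | false = Fin.punchIn-injective j x y eq

  merge-covered : ∀ x → covered (punchIn j x) → covered (merge x)
  merge-covered x cov with is-just (label κ i) in i-cov
  ... | true = cov
  ... | false with punchIn j x == i in x=i
  ...   | true =
    case trans (sym cov) (trans (cong (is-just ∘ label κ) (⌊⌋≡true⇒ x=i)) i-cov) of λ ()
  ...   | false = cov

  merge-covered-j : ∀ x → punchIn j x == i ≡ true → covered j → covered (merge x)
  merge-covered-j x x=i cov with is-just (label κ i) in i-cov
  ... | true = trans (cong (is-just ∘ label κ) (⌊⌋≡true⇒ x=i)) i-cov
  ... | false rewrite x=i = cov

  BoundedCover-contract : BoundedCover (contract G i j) s
  BoundedCover-contract = record
    { label = label κ ∘ merge
    ; label-injective = λ x↦a y↦a → merge-injective (label-injective κ x↦a y↦a)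
    ; covers = raw-cover⇒IsVertexCover _ raw-covered
    }
    where
    raw-covered : ∀ x y → raw (contract G i j) x y ≡ true →
      covered (merge x) ⊎ covered (merge y)
    raw-covered x y r with ∨-true _ _ r
    ... | inj₁ adj = map⊎ (merge-covered x) (merge-covered y) (covers κ _ _ adj)
    ... | inj₂ r′ with ∨-true _ _ r′
    ...   | inj₁ x=i∧adj =
      map⊎ (merge-covered-j x (∧-conicalˡ _ _ x=i∧adj)) (merge-covered y)
           (covers κ _ _ (∧-conicalʳ (punchIn j x == i) _ x=i∧adj))
    ...   | inj₂ y=i∧adj = swap
      (map⊎ (merge-covered-j y (∧-conicalˡ _ _ y=i∧adj)) (merge-covered x)
            (covers κ _ _ (∧-conicalʳ (punchIn j y == i) _ y=i∧adj)))

BoundedCover-minor : ∀ {h n s} {H : Graph h} {G : Graph n} →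
  Minor H G → BoundedCover G s → BoundedCover H s
BoundedCover-minor (iso H≅G) = BoundedCover-≅ H≅G
BoundedCover-minor (delV v H≼G) = BoundedCover-minor H≼G ∘ BoundedCover-deleteVertex v
BoundedCover-minor (delE i j H≼G) = BoundedCover-minor H≼G ∘ BoundedCover-deleteEdge i j
BoundedCover-minor (con i j _ H≼G) = BoundedCover-minor H≼G ∘ BoundedCover-contract i j

¬Minor-of-small-cover : ∀ {h n d s} .{{_ : NonZero d}} (H : Graph h) → Regular d H →
  (dec : Decidable (Reach H)) → 2 * s < h + odd H dec →
  {G : Graph n} → BoundedCover G s → ¬ Minor H G
¬Minor-of-small-cover {s = s} H regular dec 2s<v+odd κ H≼G =
  <⇒≱ 2s<v+odd (≤-trans (regular-cover-bound H regular dec (covers κH))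
                        (*-monoʳ-≤ 2 (BoundedCover-size κH)))
  where
  κH : BoundedCover H s
  κH = BoundedCover-minor H≼G κ

-- Complete bipartite graphs

module _ (s N : ℕ) where

  leftSide : Fin (s + N) → Maybe (Fin s)
  leftSide x = [ just , const nothing ]′ (splitAt s x)

  completeBipartite : Graph (s + N)
  completeBipartite = graph (λ x y → is-just (leftSide x) ∧ not (is-just (leftSide y)))

  leftSide-injective : ∀ {x y a} → leftSide x ≡ just a → leftSide y ≡ just a → x ≡ y
  leftSide-injective {x} {y} x↦a y↦a =
    trans (sym (leftSide⇒↑ˡ x x↦a)) (leftSide⇒↑ˡ y y↦a)
    where
    leftSide⇒↑ˡ : ∀ x {a} → leftSide x ≡ just a → a ↑ˡ N ≡ x
    leftSide⇒↑ˡ x x↦a with splitAt s x in split | x↦a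
    ... | inj₁ _ | refl = Fin.splitAt⁻¹-↑ˡ split

  completeBipartite-cover : BoundedCover completeBipartite s
  completeBipartite-cover = record
    { label = leftSide
    ; label-injective = leftSide-injective
    ; covers = raw-cover⇒IsVertexCover _ (λ x y → inj₁ ∘ ∧-conicalˡ _ _)
    }

  ↑ˡ<↑ʳ : ∀ (a : Fin s) (b : Fin N) → toℕ (a ↑ˡ N) < toℕ (s ↑ʳ b)
  ↑ˡ<↑ʳ a b = subst₂ _<_ (sym (Fin.toℕ-↑ˡ a N)) (sym (Fin.toℕ-↑ʳ s b))
                (≤-trans (Fin.toℕ<n a) (m≤m+n s (toℕ b)))

  completeBipartite-edge : ∀ a b →
    (toℕ (a ↑ˡ N) <ᵇ toℕ (s ↑ʳ b)) ∧ Adj completeBipartite (a ↑ˡ N) (s ↑ʳ b) ≡ true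
  completeBipartite-edge a b
    rewrite T⇒≡true (<⇒<ᵇ (↑ˡ<↑ʳ a b))
          | ⌊⌋≡false (a ↑ˡ N ≟ s ↑ʳ b) (<⇒≢ (↑ˡ<↑ʳ a b) ∘ cong toℕ)
          | Fin.splitAt-↑ˡ s a N | Fin.splitAt-↑ʳ s N b = refl

  completeBipartite-edges : s * N ≤ e completeBipartite
  completeBipartite-edges = begin
    s * N                                  ≡⟨ ∑-const s N ⟨
    ∑[ a < s ] N                           ≤⟨ ∑-mono-≤ {s} right-neighbours ⟩
    ∑[ a < s ] ∑[ y < s + N ] F (a ↑ˡ N) y ≤⟨ m≤m+n _ _ ⟩
    ∑[ a < s ] ∑[ y < s + N ] F (a ↑ˡ N) y
      + ∑[ b < N ] ∑[ y < s + N ] F (s ↑ʳ b) y ≡⟨ ∑-↑ s N _ ⟨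
    ∑[ x < s + N ] ∑[ y < s + N ] F x y    ≡⟨ sumF≡∑² (s + N) (s + N) F ⟨
    e completeBipartite                    ∎
    where
    open ≤-Reasoning
    F : Fin (s + N) → Fin (s + N) → ℕ
    F x y = ind ((toℕ x <ᵇ toℕ y) ∧ Adj completeBipartite x y)
    right-neighbours : ∀ a → N ≤ ∑[ y < s + N ] F (a ↑ˡ N) y
    right-neighbours a = begin
      N                                ≡⟨ trans (∑-const N 1) (*-identityʳ N) ⟨
      ∑[ b < N ] 1                     ≡⟨ sum-cong-≗ {N} (cong ind ∘ completeBipartite-edge a) ⟨
      ∑[ b < N ] F (a ↑ˡ N) (s ↑ʳ b)   ≤⟨ m≤n+m _ _ ⟩
      ∑[ x < s ] F (a ↑ˡ N) (x ↑ˡ N)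
        + ∑[ b < N ] F (a ↑ˡ N) (s ↑ʳ b) ≡⟨ ∑-↑ s N _ ⟨
      ∑[ y < s + N ] F (a ↑ˡ N) y      ∎

halve : ∀ u → ∃[ s ] 2 * s ≤ u × u ≤ suc (2 * s)
halve zero = 0 , z≤n , z≤n
halve (suc zero) = 0 , z≤n , s≤s z≤n
halve (suc (suc u)) with s , lower , upper ← halve u =
  suc s , subst (_≤ suc (suc u)) (sym (*-suc 2 s)) (s≤s (s≤s lower))
        , subst (λ k → suc (suc u) ≤ suc k) (sym (*-suc 2 s)) (s≤s (s≤s upper))

-- s = ⌈t/2⌉ - 1, the largest s with 2s < t
below-half : ∀ p m t → 2 * p + 2 * m < m * t → ∃[ s ] 2 * s < t × p < m * s
below-half p m zero hyp = ⊥-elim (n≮0 (subst (2 * p + 2 * m <_) (*-zeroʳ m) hyp))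
below-half p m (suc u) hyp with s , lower , upper ← halve u =
  s , s≤s lower , *-cancelˡ-< 2 p (m * s) (+-cancelʳ-< (2 * m) (2 * p) (2 * (m * s)) bound)
  where
  expand : ∀ m s → m * suc (suc (2 * s)) ≡ 2 * (m * s) + 2 * m
  expand = solve-∀
  bound : 2 * p + 2 * m < 2 * (m * s) + 2 * m
  bound = <-≤-trans hyp (≤-trans (*-monoʳ-≤ m (s≤s upper)) (≤-reflexive (expand m s)))

p*[s+N]<s*N*m : ∀ {p m s N} → p < m * s → p * s < N → p * (s + N) < s * N * m
p*[s+N]<s*N*m {p} {m} {s} {N} p<ms ps<N = begin-strict
  p * (s + N)   ≡⟨ *-distribˡ-+ p s N ⟩
  p * s + p * N <⟨ +-monoˡ-< (p * N) ps<N ⟩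
  suc p * N     ≤⟨ *-monoˡ-≤ N p<ms ⟩
  m * s * N     ≡⟨ reorder m s N ⟩
  s * N * m     ∎
  where
  open ≤-Reasoning
  reorder : ∀ m s N → m * s * N ≡ s * N * m
  reorder = solve-∀

corollary2p4 : ∀ {h} (H : Graph h) (dec : Decidable (Reach H)) →
    TwoRegular H →
    (p m : ℕ) → 2 * p + 2 * m < m * (h + odd H dec) →
    Σ ℕ (λ n → Σ (Graph n) (λ G →
    n ≥ 1 × ¬ Minor H G × p * n < e G * m))
corollary2p4 {h} H dec regular p m hyp
  with s , 2s<v+odd , p<ms ← below-half p m (h + odd H dec) hyp =
    s + N , completeBipartite s N
  , ≤-trans (s≤s z≤n) (m≤n+m N s)
  , ¬Minor-of-small-cover H regular dec 2s<v+odd (completeBipartite-cover s N)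
  , <-≤-trans (p*[s+N]<s*N*m p<ms (n<1+n (p * s))) (*-monoˡ-≤ m (completeBipartite-edges s N))
  where
  N : ℕ
  N = suc (p * s)
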